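{- Let $M$ be a matroid with dual matroid $M^*$, and let $k$ be a positive integer. Then $$T^k_{M^*}(x_1,\dots,x_k;y_1,\dots,y_k)=T^k_M(y_k,\dots,y_1;x_k,\dots,x_1).$$
   Context: For a matroid $M$ on ground set $\mathcal{A}$ with rank function $\mathrm{rk}$, $T^k_M((x_i)_1^k;(y_i)_1^k)=\sum_{S_1\subseteq\cdots\subseteq S_k\subseteq\mathcal{A}}\prod_{i=1}^k(x_i-1)^{\mathrm{rk}(\mathcal{A})-\mathrm{rk}(S_i)}(y_i-1)^{|S_i|-\mathrm{rk}(S_i)}$ (sum over weakly increasing chains of $k$ subsets). The dual $M^*$ has ground set $\mathcal{A}$ and rank function $\mathrm{rk}_{M^*}(X)=|X|-\mathrm{rk}(\mathcal{A})+\mathrm{rk}(\mathcal{A}-X)$. -}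

module Defs where

open import Data.Nat as ℕ using (ℕ; zero; suc; _∸_; _≤_)
open import Data.Integer as ℤ using (ℤ; _-_; _*_; _^_; +_)
open import Data.Bool using (Bool; true; false; _∧_)
open import Data.Bool.Properties using (T?)
open import Data.List as L using (List; []; _∷_; concatMap; filter)
open import Data.Vec as V using (Vec; []; _∷_; zipWith)
open import Data.Fin.Subset using (Subset; _⊆_; _∪_; _∩_; ∁; ∣_∣; ⊤)
open import Data.Fin.Subset.Properties using (_⊆?_)
open import Relation.Nullary.Decidable using (⌊_⌋)

record Matroid (n : ℕ) : Set where
  field
    rk         : Subset n → ℕ
    rk-bound   : ∀ X → rk X ≤ ∣ X ∣
    rk-mono    : ∀ {X Y} → X ⊆ Y → rk X ≤ rk Y
    rk-submod  : ∀ X Y → rk (X ∪ Y) ℕ.+ rk (X ∩ Y) ≤ rk X ℕ.+ rk Y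
open Matroid public

-- Rank function of the dual matroid:
-- rk*(X) = |X| - rk(A) + rk(A - X)   (nonnegative, computed in ℕ).
dualRank : ∀ {n} → Matroid n → Subset n → ℕ
dualRank M X = (∣ X ∣ ℕ.+ rk M (∁ X)) ∸ rk M ⊤

allSubsets : (n : ℕ) → List (Subset n)
allSubsets zero    = [] ∷ []
allSubsets (suc n) = concatMap (λ S → (true ∷ S) ∷ (false ∷ S) ∷ []) (allSubsets n)

allTuples : (n k : ℕ) → List (Vec (Subset n) k)
allTuples n zero    = [] ∷ []
allTuples n (suc k) = concatMap (λ S → L.map (S ∷_) (allTuples n k)) (allSubsets n)

isChainᵇ : ∀ {n k} → Vec (Subset n) k → Bool
isChainᵇ []                = true
isChainᵇ (S ∷ [])          = true
isChainᵇ (S ∷ (S' ∷ Ss))   = ⌊ S ⊆? S' ⌋ ∧ isChainᵇ (S' ∷ Ss)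

chains : (n k : ℕ) → List (Vec (Subset n) k)
chains n k = filter (λ c → T? (isChainᵇ c)) (allTuples n k)

Tk : ∀ {n} (k : ℕ) → (Subset n → ℕ) → Vec ℤ k → Vec ℤ k → ℤ
Tk {n} k r xs ys = L.foldr ℤ._+_ (+ 0) (L.map term (chains n k))
  where
    factor : ℤ → ℤ → Subset n → ℤ
    factor x y S = ((x - + 1) ^ (r ⊤ ∸ r S)) * ((y - + 1) ^ (∣ S ∣ ∸ r S))
    term : Vec (Subset n) k → ℤ
    term Ss = V.foldr _ _*_ (+ 1) (zipWith (λ (f : Subset n → ℤ) S → f S) (zipWith factor xs ys) Ss)

TutteK : ∀ {n} (k : ℕ) → Matroid n → Vec ℤ k → Vec ℤ k → ℤ
TutteK k M = Tk k (rk M)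

TutteKDual : ∀ {n} (k : ℕ) → Matroid n → Vec ℤ k → Vec ℤ k → ℤ
TutteKDual k M = Tk k (dualRank M)

{-# OPTIONS --safe #-}
module Submission where

-- The dual matroid has corank rk*(A) − rk*(S) = |A − S| − rk(A − S) and nullity
-- |S| − rk*(S) = rk(A) − rk(A − S), so the weight of S in T_{M*} at (x, y) is the
-- weight of A − S in T_M at (y, x).  Complementing every set of a chain
-- S₁ ⊆ ⋯ ⊆ S_k and reversing its order gives the chain A − S_k ⊆ ⋯ ⊆ A − S₁, and
-- this is a bijection on chains; reindexing the sum along it turns
-- T^k_{M*}(x; y) into T^k_M(rev y; rev x).

open import Defs
open import Data.Nat using (ℕ; _≥_)
open import Data.Integer using (ℤ)
open import Data.Vec using (Vec; reverse)
open import Relation.Binary.PropositionalEquality using (_≡_)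

open import Data.Nat as ℕ using (zero; suc; _∸_; _≤_)
import Data.Nat.Properties as ℕ
open import Data.Integer as ℤ using (+_; _+_; _*_; _-_; _^_)
import Data.Integer.Properties as ℤ
open import Algebra.Properties.CommutativeSemigroup ℤ.+-commutativeSemigroup using (interchange)
open import Data.Bool using (Bool; true; false; _∧_; if_then_else_)
open import Data.Bool.Properties as Bool using (T?)
open import Data.List as List using (List; []; _∷_; _++_; concatMap; filter)
open import Data.Vec as Vec using ([]; _∷_; _∷ʳ_)
import Data.Vec.Properties as Vec
open import Data.Fin.Subset using (Subset; _∪_; _∩_; ∁; ∣_∣; ⊤; ⊥)
open import Data.Fin.Subset.Properties
  using (_⊆?_; ⊆⊤; ∣⊥∣≡0; ∣⊤∣≡n; ∣∁p∣≡n∸∣p∣; p∪∁p≡⊤; p⊆q⇒∁p⊇∁q; ∁p⊆∁q⇒p⊇q)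
open import Relation.Nullary.Decidable using (⌊_⌋; yes; no)
open import Relation.Nullary.Negation using (contradiction)
open import Relation.Binary.PropositionalEquality
  using (refl; sym; trans; cong; cong₂; subst; module ≡-Reasoning)
open import Function using (_∘_; flip)

private variable
  A B : Set

∑ : List A → (A → ℤ) → ℤ
∑ xs f = List.foldr _+_ (+ 0) (List.map f xs)

infix 5 ∑
syntax ∑ xs (λ x → e) = ∑[ x ← xs ] e

∑-cong : ∀ (xs : List A) {f g : A → ℤ} → (∀ a → f a ≡ g a) → ∑ xs f ≡ ∑ xs g
∑-cong []       f≗g = refl
∑-cong (x ∷ xs) f≗g = cong₂ _+_ (f≗g x) (∑-cong xs f≗g)

∑-++ : ∀ (xs ys : List A) (f : A → ℤ) → ∑ (xs ++ ys) f ≡ ∑ xs f + ∑ ys f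
∑-++ []       ys f = sym (ℤ.+-identityˡ _)
∑-++ (x ∷ xs) ys f = trans (cong (_+_ (f x)) (∑-++ xs ys f)) (sym (ℤ.+-assoc (f x) _ _))

∑-pair : ∀ (a b : A) (f : A → ℤ) → ∑ (a ∷ b ∷ []) f ≡ f a + f b
∑-pair a b f = cong (_+_ (f a)) (ℤ.+-identityʳ (f b))

∑-0 : ∀ (xs : List A) → ∑[ _ ← xs ] + 0 ≡ + 0
∑-0 []       = refl
∑-0 (x ∷ xs) = trans (ℤ.+-identityˡ _) (∑-0 xs)

∑-+ : ∀ (xs : List A) (f g : A → ℤ) → ∑[ a ← xs ] (f a + g a) ≡ ∑ xs f + ∑ xs g
∑-+ []       f g = refl
∑-+ (x ∷ xs) f g =
  trans (cong (_+_ (f x + g x)) (∑-+ xs f g)) (interchange (f x) (g x) (∑ xs f) (∑ xs g))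

∑-filter : ∀ (p : A → Bool) (xs : List A) (f : A → ℤ) →
  ∑ (filter (λ a → T? (p a)) xs) f ≡ ∑[ a ← xs ] (if p a then f a else + 0)
∑-filter p []       f = refl
∑-filter p (x ∷ xs) f with p x
... | true  = cong (_+_ (f x)) (∑-filter p xs f)
... | false = trans (∑-filter p xs f) (sym (ℤ.+-identityˡ _))

∑-map : ∀ (h : A → B) (xs : List A) (f : B → ℤ) → ∑ (List.map h xs) f ≡ ∑ xs (f ∘ h)
∑-map h []       f = refl
∑-map h (x ∷ xs) f = cong (_+_ (f (h x))) (∑-map h xs f)

∑-concatMap : ∀ (g : A → List B) (xs : List A) (f : B → ℤ) →
  ∑ (concatMap g xs) f ≡ ∑[ a ← xs ] ∑ (g a) f
∑-concatMap g []       f = refl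
∑-concatMap g (x ∷ xs) f =
  trans (∑-++ (g x) (concatMap g xs) f) (cong (_+_ (∑ (g x) f)) (∑-concatMap g xs f))

∑-comm : ∀ (xs : List A) (ys : List B) (f : A → B → ℤ) →
  ∑[ a ← xs ] ∑[ b ← ys ] f a b ≡ ∑[ b ← ys ] ∑[ a ← xs ] f a b
∑-comm []       ys f = sym (∑-0 ys)
∑-comm (x ∷ xs) ys f =
  trans (cong (_+_ (∑ ys (f x))) (∑-comm xs ys f)) (sym (∑-+ ys (f x) _))

∑-subsets-∁ : ∀ n (f : Subset n → ℤ) → ∑ (allSubsets n) f ≡ ∑ (allSubsets n) (f ∘ ∁)
∑-subsets-∁ zero    f = refl
∑-subsets-∁ (suc n) f = begin
  ∑ (allSubsets (suc n)) f                     ≡⟨ ∑-concatMap pair (allSubsets n) f ⟩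
  ∑[ S ← allSubsets n ] ∑ (pair S) f           ≡⟨ ∑-subsets-∁ n _ ⟩
  ∑[ S ← allSubsets n ] ∑ (pair (∁ S)) f       ≡⟨ ∑-cong (allSubsets n) swap ⟩
  ∑[ S ← allSubsets n ] ∑ (pair S) (f ∘ ∁)     ≡⟨ ∑-concatMap pair (allSubsets n) (f ∘ ∁) ⟨
  ∑ (allSubsets (suc n)) (f ∘ ∁)               ∎
  where
  open ≡-Reasoning
  pair : Subset n → List (Subset (suc n))
  pair S = (true ∷ S) ∷ (false ∷ S) ∷ []
  swap : ∀ S → ∑ (pair (∁ S)) f ≡ ∑ (pair S) (f ∘ ∁)
  swap S = trans (∑-pair _ _ f)
          (trans (ℤ.+-comm (f (true ∷ ∁ S)) _) (sym (∑-pair _ _ (f ∘ ∁))))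

module _ (n : ℕ) where

  ∑-tuples-∷ : ∀ k (F : Vec (Subset n) (suc k) → ℤ) →
    ∑ (allTuples n (suc k)) F ≡ ∑[ S ← allSubsets n ] ∑[ c ← allTuples n k ] F (S ∷ c)
  ∑-tuples-∷ k F =
    trans (∑-concatMap (λ S → List.map (S ∷_) (allTuples n k)) (allSubsets n) F)
          (∑-cong (allSubsets n) (λ S → ∑-map (S ∷_) (allTuples n k) F))

  ∑-tuples-∷ʳ : ∀ k (F : Vec (Subset n) (suc k) → ℤ) →
    ∑ (allTuples n (suc k)) F ≡ ∑[ c ← allTuples n k ] ∑[ S ← allSubsets n ] F (c ∷ʳ S)
  ∑-tuples-∷ʳ zero    F = trans (∑-tuples-∷ zero F)
    (trans (∑-cong (allSubsets n) (λ S → ℤ.+-identityʳ (F (S ∷ [])))) (sym (ℤ.+-identityʳ _)))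
  ∑-tuples-∷ʳ (suc k) F = begin
    ∑ (allTuples n (suc (suc k))) F
      ≡⟨ ∑-tuples-∷ (suc k) F ⟩
    ∑[ T ← allSubsets n ] ∑[ c ← allTuples n (suc k) ] F (T ∷ c)
      ≡⟨ ∑-cong (allSubsets n) (λ T → ∑-tuples-∷ʳ k (λ c → F (T ∷ c))) ⟩
    ∑[ T ← allSubsets n ] ∑[ c ← allTuples n k ] ∑[ S ← allSubsets n ] F (T ∷ (c ∷ʳ S))
      ≡⟨ ∑-tuples-∷ k (λ c → ∑[ S ← allSubsets n ] F (c ∷ʳ S)) ⟨
    ∑[ c ← allTuples n (suc k) ] ∑[ S ← allSubsets n ] F (c ∷ʳ S) ∎
    where open ≡-Reasoning

  ∑-tuples-map : ∀ (h : Subset n → Subset n) →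
    (∀ f → ∑ (allSubsets n) f ≡ ∑ (allSubsets n) (f ∘ h)) →
    ∀ k (F : Vec (Subset n) k → ℤ) → ∑ (allTuples n k) F ≡ ∑ (allTuples n k) (F ∘ Vec.map h)
  ∑-tuples-map h ∑-h zero    F = refl
  ∑-tuples-map h ∑-h (suc k) F = begin
    ∑ (allTuples n (suc k)) F
      ≡⟨ ∑-tuples-∷ k F ⟩
    ∑[ S ← allSubsets n ] ∑[ c ← allTuples n k ] F (S ∷ c)
      ≡⟨ ∑-cong (allSubsets n) (λ S → ∑-tuples-map h ∑-h k (λ c → F (S ∷ c))) ⟩
    ∑[ S ← allSubsets n ] ∑[ c ← allTuples n k ] F (S ∷ Vec.map h c)
      ≡⟨ ∑-h _ ⟩
    ∑[ S ← allSubsets n ] ∑[ c ← allTuples n k ] F (h S ∷ Vec.map h c)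
      ≡⟨ ∑-tuples-∷ k (F ∘ Vec.map h) ⟨
    ∑ (allTuples n (suc k)) (F ∘ Vec.map h) ∎
    where open ≡-Reasoning

  ∑-tuples-reverse : ∀ k (F : Vec (Subset n) k → ℤ) →
    ∑ (allTuples n k) F ≡ ∑ (allTuples n k) (F ∘ reverse)
  ∑-tuples-reverse zero    F = refl
  ∑-tuples-reverse (suc k) F = sym (begin
    ∑ (allTuples n (suc k)) (F ∘ reverse)
      ≡⟨ ∑-tuples-∷ k (F ∘ reverse) ⟩
    ∑[ S ← allSubsets n ] ∑[ c ← allTuples n k ] F (reverse (S ∷ c))
      ≡⟨ ∑-cong (allSubsets n) (λ S → ∑-cong (allTuples n k) (λ c → cong F (Vec.reverse-∷ S c))) ⟩
    ∑[ S ← allSubsets n ] ∑[ c ← allTuples n k ] F (reverse c ∷ʳ S)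
      ≡⟨ ∑-cong (allSubsets n) (λ S → ∑-tuples-reverse k (λ c → F (c ∷ʳ S))) ⟨
    ∑[ S ← allSubsets n ] ∑[ c ← allTuples n k ] F (c ∷ʳ S)
      ≡⟨ ∑-comm (allSubsets n) (allTuples n k) (λ S c → F (c ∷ʳ S)) ⟩
    ∑[ c ← allTuples n k ] ∑[ S ← allSubsets n ] F (c ∷ʳ S)
      ≡⟨ ∑-tuples-∷ʳ k F ⟨
    ∑ (allTuples n (suc k)) F ∎)
    where open ≡-Reasoning

module _ (R : A → A → Bool) where

  linkedᵇ : ∀ {k} → Vec A k → Bool
  linkedᵇ []           = true
  linkedᵇ (x ∷ [])     = true
  linkedᵇ (x ∷ y ∷ ys) = R x y ∧ linkedᵇ (y ∷ ys)

  linkedᵇ-∷ʳ-∷ʳ : ∀ {k} (zs : Vec A k) (y x : A) →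
    linkedᵇ (zs ∷ʳ y ∷ʳ x) ≡ linkedᵇ (zs ∷ʳ y) ∧ R y x
  linkedᵇ-∷ʳ-∷ʳ []           y x = Bool.∧-identityʳ (R y x)
  linkedᵇ-∷ʳ-∷ʳ (w ∷ [])     y x =
    trans (cong (R w y ∧_) (Bool.∧-identityʳ (R y x))) (sym (Bool.∧-assoc (R w y) true (R y x)))
  linkedᵇ-∷ʳ-∷ʳ (w ∷ v ∷ vs) y x =
    trans (cong (R w v ∧_) (linkedᵇ-∷ʳ-∷ʳ (v ∷ vs) y x)) (sym (Bool.∧-assoc (R w v) _ (R y x)))

linkedᵇ-reverse : ∀ {k} (R : A → A → Bool) (c : Vec A k) →
  linkedᵇ R (reverse c) ≡ linkedᵇ (flip R) c
linkedᵇ-reverse R []           = refl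
linkedᵇ-reverse R (a ∷ [])     = refl
linkedᵇ-reverse R (a ∷ b ∷ cs) = begin
  linkedᵇ R (reverse (a ∷ b ∷ cs))
    ≡⟨ cong (linkedᵇ R) (trans (Vec.reverse-∷ a (b ∷ cs)) (cong (_∷ʳ a) (Vec.reverse-∷ b cs))) ⟩
  linkedᵇ R (reverse cs ∷ʳ b ∷ʳ a)
    ≡⟨ linkedᵇ-∷ʳ-∷ʳ R (reverse cs) b a ⟩
  linkedᵇ R (reverse cs ∷ʳ b) ∧ R b a
    ≡⟨ cong (λ v → linkedᵇ R v ∧ R b a) (Vec.reverse-∷ b cs) ⟨
  linkedᵇ R (reverse (b ∷ cs)) ∧ R b a
    ≡⟨ cong (_∧ R b a) (linkedᵇ-reverse R (b ∷ cs)) ⟩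
  linkedᵇ (flip R) (b ∷ cs) ∧ R b a
    ≡⟨ Bool.∧-comm _ (R b a) ⟩
  linkedᵇ (flip R) (a ∷ b ∷ cs) ∎
  where open ≡-Reasoning

linkedᵇ-map : ∀ {k} (R : A → A → Bool) (R′ : B → B → Bool) (h : B → A) →
  (∀ a b → R (h a) (h b) ≡ R′ a b) → (c : Vec B k) → linkedᵇ R (Vec.map h c) ≡ linkedᵇ R′ c
linkedᵇ-map R R′ h hR≡R′ []           = refl
linkedᵇ-map R R′ h hR≡R′ (a ∷ [])     = refl
linkedᵇ-map R R′ h hR≡R′ (a ∷ b ∷ cs) = cong₂ _∧_ (hR≡R′ a b) (linkedᵇ-map R R′ h hR≡R′ (b ∷ cs))

_⊆ᵇ_ : ∀ {n} → Subset n → Subset n → Bool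
S ⊆ᵇ T = ⌊ S ⊆? T ⌋

∁-⊆ᵇ-∁ : ∀ {n} (S T : Subset n) → (∁ T ⊆ᵇ ∁ S) ≡ (S ⊆ᵇ T)
∁-⊆ᵇ-∁ S T with ∁ T ⊆? ∁ S | S ⊆? T
... | yes _       | yes _    = refl
... | no _        | no _     = refl
... | yes ∁T⊆∁S   | no S⊈T   = contradiction (λ {x} → ∁p⊆∁q⇒p⊇q ∁T⊆∁S {x}) S⊈T
... | no ∁T⊈∁S    | yes S⊆T  = contradiction (λ {x} → p⊆q⇒∁p⊇∁q S⊆T {x}) ∁T⊈∁S

isChainᵇ≡linkedᵇ-⊆ᵇ : ∀ {n k} (c : Vec (Subset n) k) → isChainᵇ c ≡ linkedᵇ _⊆ᵇ_ c
isChainᵇ≡linkedᵇ-⊆ᵇ []           = refl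
isChainᵇ≡linkedᵇ-⊆ᵇ (x ∷ [])     = refl
isChainᵇ≡linkedᵇ-⊆ᵇ (x ∷ y ∷ ys) = cong (x ⊆ᵇ y ∧_) (isChainᵇ≡linkedᵇ-⊆ᵇ (y ∷ ys))

isChainᵇ-reverse-∁ : ∀ {n k} (c : Vec (Subset n) k) → isChainᵇ (reverse (Vec.map ∁ c)) ≡ isChainᵇ c
isChainᵇ-reverse-∁ c = begin
  isChainᵇ (reverse (Vec.map ∁ c))         ≡⟨ isChainᵇ≡linkedᵇ-⊆ᵇ (reverse (Vec.map ∁ c)) ⟩
  linkedᵇ _⊆ᵇ_ (reverse (Vec.map ∁ c))     ≡⟨ linkedᵇ-reverse _⊆ᵇ_ (Vec.map ∁ c) ⟩
  linkedᵇ (flip _⊆ᵇ_) (Vec.map ∁ c)        ≡⟨ linkedᵇ-map (flip _⊆ᵇ_) _⊆ᵇ_ ∁ ∁-⊆ᵇ-∁ c ⟩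
  linkedᵇ _⊆ᵇ_ c                           ≡⟨ isChainᵇ≡linkedᵇ-⊆ᵇ c ⟨
  isChainᵇ c                               ∎
  where open ≡-Reasoning

∑-chains-reverse-∁ : ∀ n k (F : Vec (Subset n) k → ℤ) →
  ∑ (chains n k) F ≡ ∑ (chains n k) (F ∘ reverse ∘ Vec.map ∁)
∑-chains-reverse-∁ n k F = begin
  ∑ (chains n k) F
    ≡⟨ ∑-filter isChainᵇ (allTuples n k) F ⟩
  ∑ (allTuples n k) G
    ≡⟨ ∑-tuples-reverse n k G ⟩
  ∑ (allTuples n k) (G ∘ reverse)
    ≡⟨ ∑-tuples-map n ∁ (∑-subsets-∁ n) k (G ∘ reverse) ⟩
  ∑ (allTuples n k) (G ∘ reverse ∘ Vec.map ∁)
    ≡⟨ ∑-cong (allTuples n k) indicator ⟩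
  ∑[ c ← allTuples n k ] (if isChainᵇ c then F′ c else + 0)
    ≡⟨ ∑-filter isChainᵇ (allTuples n k) F′ ⟨
  ∑ (chains n k) F′ ∎
  where
  open ≡-Reasoning
  F′ : Vec (Subset n) k → ℤ
  F′ = F ∘ reverse ∘ Vec.map ∁
  G : Vec (Subset n) k → ℤ
  G c = if isChainᵇ c then F c else + 0
  indicator : ∀ c → G (reverse (Vec.map ∁ c)) ≡ (if isChainᵇ c then F′ c else + 0)
  indicator c = cong (λ b → if b then F′ c else + 0) (isChainᵇ-reverse-∁ c)

module _ {n : ℕ} (r : Subset n → ℕ) where

  weight : ℤ → ℤ → Subset n → ℤ
  weight x y S = ((x - + 1) ^ (r ⊤ ∸ r S)) * ((y - + 1) ^ (∣ S ∣ ∸ r S))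

  chainWeight : ∀ {k} → Vec ℤ k → Vec ℤ k → Vec (Subset n) k → ℤ
  chainWeight []       []       []       = + 1
  chainWeight (x ∷ xs) (y ∷ ys) (S ∷ Ss) = weight x y S * chainWeight xs ys Ss

  Tk≡∑-chainWeight : ∀ k (xs ys : Vec ℤ k) → Tk k r xs ys ≡ ∑ (chains n k) (chainWeight xs ys)
  Tk≡∑-chainWeight k xs ys = ∑-cong (chains n k) (term≡chainWeight xs ys)
    where
    term≡chainWeight : ∀ {k} (xs ys : Vec ℤ k) (Ss : Vec (Subset n) k) →
      Vec.foldr _ _*_ (+ 1) (Vec.zipWith (λ (f : Subset n → ℤ) S → f S) (Vec.zipWith weight xs ys) Ss)
        ≡ chainWeight xs ys Ss
    term≡chainWeight []       []       []       = refl
    term≡chainWeight (x ∷ xs) (y ∷ ys) (S ∷ Ss) = cong (weight x y S *_) (term≡chainWeight xs ys Ss)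

  chainWeight-∷ʳ : ∀ {k} (xs ys : Vec ℤ k) (Ss : Vec (Subset n) k) x y S →
    chainWeight (xs ∷ʳ x) (ys ∷ʳ y) (Ss ∷ʳ S) ≡ chainWeight xs ys Ss * weight x y S
  chainWeight-∷ʳ []         []         []         x y S =
    trans (ℤ.*-identityʳ _) (sym (ℤ.*-identityˡ _))
  chainWeight-∷ʳ (x′ ∷ xs) (y′ ∷ ys) (S′ ∷ Ss) x y S =
    trans (cong (weight x′ y′ S′ *_) (chainWeight-∷ʳ xs ys Ss x y S))
          (sym (ℤ.*-assoc (weight x′ y′ S′) _ _))

  chainWeight-reverse : ∀ {k} (xs ys : Vec ℤ k) (Ss : Vec (Subset n) k) →
    chainWeight (reverse xs) (reverse ys) (reverse Ss) ≡ chainWeight xs ys Ss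
  chainWeight-reverse []       []       []       = refl
  chainWeight-reverse (x ∷ xs) (y ∷ ys) (S ∷ Ss) = begin
    chainWeight (reverse (x ∷ xs)) (reverse (y ∷ ys)) (reverse (S ∷ Ss))
      ≡⟨ cong₂ (λ u v → chainWeight u v _) (Vec.reverse-∷ x xs) (Vec.reverse-∷ y ys) ⟩
    chainWeight (reverse xs ∷ʳ x) (reverse ys ∷ʳ y) (reverse (S ∷ Ss))
      ≡⟨ cong (chainWeight (reverse xs ∷ʳ x) (reverse ys ∷ʳ y)) (Vec.reverse-∷ S Ss) ⟩
    chainWeight (reverse xs ∷ʳ x) (reverse ys ∷ʳ y) (reverse Ss ∷ʳ S)
      ≡⟨ chainWeight-∷ʳ (reverse xs) (reverse ys) (reverse Ss) x y S ⟩
    chainWeight (reverse xs) (reverse ys) (reverse Ss) * weight x y S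
      ≡⟨ cong (_* weight x y S) (chainWeight-reverse xs ys Ss) ⟩
    chainWeight xs ys Ss * weight x y S
      ≡⟨ ℤ.*-comm _ (weight x y S) ⟩
    chainWeight (x ∷ xs) (y ∷ ys) (S ∷ Ss) ∎
    where open ≡-Reasoning

m∸o∸[n∸o]≡m∸n : ∀ m {n o} → o ≤ n → m ∸ o ∸ (n ∸ o) ≡ m ∸ n
m∸o∸[n∸o]≡m∸n m {n} {o} o≤n = trans (ℕ.∸-+-assoc m o (n ∸ o)) (cong (m ∸_) (ℕ.m+[n∸m]≡n o≤n))

[m+o]∸[n+o]≡m∸n : ∀ m n o → (m ℕ.+ o) ∸ (n ℕ.+ o) ≡ m ∸ n
[m+o]∸[n+o]≡m∸n m n o =
  trans (cong₂ _∸_ (ℕ.+-comm m o) (ℕ.+-comm n o)) (ℕ.[m+n]∸[m+o]≡n∸o o m n)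

m∸[m+n∸o]≡o∸n : ∀ m {n o} → n ≤ o → o ≤ m ℕ.+ n → m ∸ (m ℕ.+ n ∸ o) ≡ o ∸ n
m∸[m+n∸o]≡o∸n m {n} {o} n≤o o≤m+n = begin
  m ∸ (m ℕ.+ n ∸ o)                ≡⟨ cong (λ z → m ∸ (m ℕ.+ n ∸ z)) (ℕ.m∸n+n≡m n≤o) ⟨
  m ∸ (m ℕ.+ n ∸ (o ∸ n ℕ.+ n))    ≡⟨ cong (m ∸_) ([m+o]∸[n+o]≡m∸n m (o ∸ n) n) ⟩
  m ∸ (m ∸ (o ∸ n))                ≡⟨ ℕ.m∸[m∸n]≡n o∸n≤m ⟩
  o ∸ n                            ∎
  where
  open ≡-Reasoning
  o∸n≤m : o ∸ n ≤ m
  o∸n≤m = subst (o ∸ n ≤_) (ℕ.m+n∸n≡m m n) (ℕ.∸-monoˡ-≤ n o≤m+n)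

∁⊤≡⊥ : ∀ n → ∁ (⊤ {n}) ≡ ⊥
∁⊤≡⊥ n = Vec.map-replicate _ true n

module _ {n : ℕ} (M : Matroid n) where

  rk-⊥ : rk M ⊥ ≡ 0
  rk-⊥ = ℕ.n≤0⇒n≡0 (subst (rk M ⊥ ≤_) (∣⊥∣≡0 n) (rk-bound M ⊥))

  dualRank-⊤ : dualRank M ⊤ ≡ n ∸ rk M ⊤
  dualRank-⊤ = cong (_∸ rk M ⊤)
    (trans (cong₂ ℕ._+_ (∣⊤∣≡n n) (trans (cong (rk M) (∁⊤≡⊥ n)) rk-⊥))
           (ℕ.+-identityʳ n))

  -- Submodularity on S and ∁ S: the truncated subtraction in dualRank never truncates.
  rk-⊤≤∣S∣+rk-∁S : ∀ S → rk M ⊤ ≤ ∣ S ∣ ℕ.+ rk M (∁ S)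
  rk-⊤≤∣S∣+rk-∁S S = begin
    rk M ⊤                                   ≡⟨ cong (rk M) (p∪∁p≡⊤ S) ⟨
    rk M (S ∪ ∁ S)                           ≤⟨ ℕ.m≤m+n _ _ ⟩
    rk M (S ∪ ∁ S) ℕ.+ rk M (S ∩ ∁ S)        ≤⟨ rk-submod M S (∁ S) ⟩
    rk M S ℕ.+ rk M (∁ S)                    ≤⟨ ℕ.+-monoˡ-≤ _ (rk-bound M S) ⟩
    ∣ S ∣ ℕ.+ rk M (∁ S)                     ∎
    where open ℕ.≤-Reasoning

  dual-corank : ∀ S → dualRank M ⊤ ∸ dualRank M S ≡ ∣ ∁ S ∣ ∸ rk M (∁ S)
  dual-corank S = begin
    dualRank M ⊤ ∸ dualRank M S                       ≡⟨ cong (_∸ dualRank M S) dualRank-⊤ ⟩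
    n ∸ rk M ⊤ ∸ (∣ S ∣ ℕ.+ rk M (∁ S) ∸ rk M ⊤)      ≡⟨ m∸o∸[n∸o]≡m∸n n (rk-⊤≤∣S∣+rk-∁S S) ⟩
    n ∸ (∣ S ∣ ℕ.+ rk M (∁ S))                        ≡⟨ ℕ.∸-+-assoc n ∣ S ∣ _ ⟨
    n ∸ ∣ S ∣ ∸ rk M (∁ S)                            ≡⟨ cong (_∸ rk M (∁ S)) (∣∁p∣≡n∸∣p∣ S) ⟨
    ∣ ∁ S ∣ ∸ rk M (∁ S)                              ∎
    where open ≡-Reasoning

  dual-nullity : ∀ S → ∣ S ∣ ∸ dualRank M S ≡ rk M ⊤ ∸ rk M (∁ S)
  dual-nullity S = m∸[m+n∸o]≡o∸n ∣ S ∣ (rk-mono M ⊆⊤) (rk-⊤≤∣S∣+rk-∁S S)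

  weight-dual : ∀ x y S → weight (dualRank M) x y S ≡ weight (rk M) y x (∁ S)
  weight-dual x y S =
    trans (cong₂ (λ u v → ((x - + 1) ^ u) * ((y - + 1) ^ v)) (dual-corank S) (dual-nullity S))
          (ℤ.*-comm ((x - + 1) ^ (∣ ∁ S ∣ ∸ rk M (∁ S))) _)

  chainWeight-dual : ∀ {k} (xs ys : Vec ℤ k) (Ss : Vec (Subset n) k) →
    chainWeight (dualRank M) xs ys Ss ≡ chainWeight (rk M) ys xs (Vec.map ∁ Ss)
  chainWeight-dual []       []       []       = refl
  chainWeight-dual (x ∷ xs) (y ∷ ys) (S ∷ Ss) = cong₂ _*_ (weight-dual x y S) (chainWeight-dual xs ys Ss)

proposition3p4 : ∀ {n : ℕ} (M : Matroid n) (k : ℕ) → k ≥ 1 →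
    (xs ys : Vec ℤ k) →
    TutteKDual k M xs ys ≡ TutteK k M (reverse ys) (reverse xs)
proposition3p4 {n} M k _ xs ys = begin
  Tk k (dualRank M) xs ys
    ≡⟨ Tk≡∑-chainWeight (dualRank M) k xs ys ⟩
  ∑ (chains n k) (chainWeight (dualRank M) xs ys)
    ≡⟨ ∑-cong (chains n k) (chainWeight-dual M xs ys) ⟩
  ∑[ c ← chains n k ] chainWeight (rk M) ys xs (Vec.map ∁ c)
    ≡⟨ ∑-cong (chains n k) (λ c → chainWeight-reverse (rk M) ys xs (Vec.map ∁ c)) ⟨
  ∑[ c ← chains n k ] chainWeight (rk M) (reverse ys) (reverse xs) (reverse (Vec.map ∁ c))
    ≡⟨ ∑-chains-reverse-∁ n k _ ⟨
  ∑ (chains n k) (chainWeight (rk M) (reverse ys) (reverse xs))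
    ≡⟨ Tk≡∑-chainWeight (rk M) k (reverse ys) (reverse xs) ⟨
  Tk k (rk M) (reverse ys) (reverse xs) ∎
  where open ≡-Reasoning
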